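{- Let $p>1$ be an integer. Every $5$-regular Cayley graph on the group $\mathbb{Z}_2\times\mathbb{Z}_{2p}$ has an internal partition.
   Context: For a finite additive group $K$ and $S\subseteq K$ with $0\notin S$, $S=-S$, the Cayley graph $Cay(K;S)$ has vertex set $K$ and $x\sim y$ iff $y-x\in S$; it is $5$-regular iff $|S|=5$. An internal partition of a graph is a partition of the vertex set into two nonempty sets such that every vertex has at least as many neighbours in its own class as in the other class. -}

module Defs where

open import Data.Nat using (ℕ; suc; _+_; _*_; _∸_; _≤_; NonZero)
open import Data.Nat.DivMod using (_mod_)
open import Data.Fin using (Fin; toℕ)
open import Data.Product using (_×_; _,_; ∃; ∃-syntax; proj₁; proj₂)
open import Data.Bool using (Bool; true; false; if_then_else_)
open import Data.List using (List; length; filter)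
open import Data.List.Membership.Propositional using (_∈_; _∉_)
open import Data.List.Relation.Unary.Unique.Propositional using (Unique)
open import Relation.Binary.PropositionalEquality using (_≡_; _≢_)
open import Relation.Nullary.Decidable using (¬?)
open import Data.Bool.Properties using () renaming (_≟_ to _≟ᵇ_)

module _ (n : ℕ) .{{_ : NonZero n}} where
  addₙ : Fin n → Fin n → Fin n
  addₙ a b = (toℕ a + toℕ b) mod n

  negₙ : Fin n → Fin n
  negₙ a = (n ∸ toℕ a) mod n

  zeroₙ : Fin n
  zeroₙ = 0 mod n

Z2xZ : ℕ → Set
Z2xZ m = Fin 2 × Fin m

module _ (m : ℕ) .{{_ : NonZero m}} where
  _⊕_ : Z2xZ m → Z2xZ m → Z2xZ m
  (a , b) ⊕ (c , d) = addₙ 2 a c , addₙ m b d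

  ⊖_ : Z2xZ m → Z2xZ m
  ⊖ (a , b) = negₙ 2 a , negₙ m b

  𝟘 : Z2xZ m
  𝟘 = zeroₙ 2 , zeroₙ m

  record FiveRegularConnectionSet (S : List (Z2xZ m)) : Set where
    field
      distinct   : Unique S
      size5      : length S ≡ 5
      zero∉S     : 𝟘 ∉ S
      symmetric  : ∀ s → s ∈ S → (⊖ s) ∈ S

  -- In Cay(K;S), the neighbours of x are exactly x + s for s ∈ S
  -- (distinct for distinct s).  For a 2-colouring A : K → Bool,
  -- the number of neighbours of x in its own class / the other class:
  sameNbrs : List (Z2xZ m) → (Z2xZ m → Bool) → Z2xZ m → ℕ
  sameNbrs S A x = length (filter (λ s → A (x ⊕ s) ≟ᵇ A x) S)

  otherNbrs : List (Z2xZ m) → (Z2xZ m → Bool) → Z2xZ m → ℕ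
  otherNbrs S A x = length (filter (λ s → ¬? (A (x ⊕ s) ≟ᵇ A x)) S)

  record InternalPartition (S : List (Z2xZ m)) : Set where
    field
      colour       : Z2xZ m → Bool
      trueClass≠∅  : ∃[ x ] colour x ≡ true
      falseClass≠∅ : ∃[ x ] colour x ≡ false
      internal     : ∀ x → otherNbrs S colour x ≤ sameNbrs S colour x

open import Data.Nat using (_<_; s≤s)
2p≢0 : ∀ {p} → 1 < p → NonZero (2 * p)
2p≢0 {suc p} _ = _

module Submission where

-- The parities of the two coordinates map G = ℤ₂ × ℤ₂ₚ onto the Klein four-group, whose three
-- characters χ have kernels of index 2 in G. If one of these kernels contains three elements of S,
-- its two cosets form an internal partition. Otherwise, since 0 lies in all three kernels and every
-- other element of the Klein group in exactly one, the kernels contain 1, 2 and 2 elements of S: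
-- an involution c, and a, b with ±a, ±b in the other two kernels. It then suffices to colour G so
-- that c, one of ±a and one of ±b keep every x on its side. For p even, x ↦ x₂ + x₂(c)·x₁ is a
-- homomorphism onto ℤ₄ killing c and making a, b odd, and the halves {0, 1}, {2, 3} of ℤ₄ do it.
-- For p odd, map x to the layer χ(x) ∈ ℤ₂ (χ the character with c in its kernel) and x₂ mod p;
-- the preimage of the square (0, 0), (1, α), (0, α + β), (1, β) is a side in which every vertex
-- keeps two of x ± a, x ± b, and so does every vertex off it, because 2 is invertible mod p.

open import Defs

open import Data.Nat
open import Data.Nat.Properties
open import Data.Nat.DivMod hiding (_mod_)
open import Data.Nat.Divisibility using (_∣_; divides)
open import Data.Nat.Tactic.RingSolver using (solve-∀)
open import Data.Parity as ℙ using (Parity; 0ℙ; 1ℙ)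
import Data.Parity.Properties as ℙ
open import Data.Sign as Sign using (Sign)
open import Data.Fin as Fin using (Fin; toℕ)
open import Data.Fin.Properties using (toℕ-fromℕ<; toℕ<n; toℕ-injective)
open import Data.Bool using (Bool; true; false)
open import Data.Bool.Properties using () renaming (_≟_ to _≟ᵇ_)
open import Data.Product using (∃-syntax; _×_; _,_; proj₁; proj₂)
open import Data.Product.Properties using (≡-dec; ×-≡,≡→≡)
open import Data.Sum as Sum using (_⊎_; inj₁; inj₂)
open import Data.List using (List; []; _∷_; length; filter; map)
open import Data.List.Properties using (length-map; filter-some)
open import Data.List.Membership.Propositional using (_∈_)
open import Data.List.Membership.Propositional.Properties using (∈-filter⁺; ∈-filter⁻)
open import Data.List.Relation.Unary.All using ([]; _∷_; lookup)
open import Data.List.Relation.Unary.AllPairs using ([]; _∷_)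
open import Data.List.Relation.Unary.Any as Any using (here; there)
import Data.List.Relation.Unary.Any.Properties as Any
open import Data.List.Relation.Unary.Unique.Propositional using (Unique)
import Data.List.Relation.Unary.Unique.Propositional.Properties as Unique
open import Data.List.Relation.Binary.Subset.Propositional using (_⊆_)
open import Data.List.Relation.Binary.Sublist.Propositional using (⊆-refl)
open import Data.List.Relation.Binary.Sublist.Propositional.Properties using (filter⁺; length-mono-≤)
open import Relation.Nullary using (¬_; Dec; yes; no; does; contradiction)
open import Relation.Nullary.Decidable using (dec-true; dec-false; _⊎-dec_)
open import Relation.Unary using (Pred; Decidable)
open import Relation.Unary.Properties using (∁?)
open import Relation.Binary using (Setoid; DecidableEquality)
open import Relation.Binary.PropositionalEquality
open import Algebra.Properties.CommutativeSemigroup ℙ.+-commutativeSemigroup using (interchange)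
open import Function using (_∘_; case_of_)
open import Level using (0ℓ)

module _ {A : Set} {P : Pred A 0ℓ} (P? : Decidable P) where

  length-filter+length-filter-∁ : ∀ xs → length (filter P? xs) + length (filter (∁? P?) xs) ≡ length xs
  length-filter+length-filter-∁ [] = refl
  length-filter+length-filter-∁ (x ∷ xs) with P? x
  ... | yes _ = cong suc (length-filter+length-filter-∁ xs)
  ... | no _ = trans (+-suc _ _) (cong suc (length-filter+length-filter-∁ xs))

  length-filter-map : ∀ {B : Set} (f : B → A) xs → length (filter P? (map f xs)) ≡ length (filter (P? ∘ f) xs)
  length-filter-map f [] = refl
  length-filter-map f (x ∷ xs) with does (P? (f x))
  ... | true = cong suc (length-filter-map f xs)
  ... | false = length-filter-map f xs

  filter-∁-≤-filter-of-five : ∀ xs → length xs ≡ 5 → 3 ≤ length (filter P? xs) →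
                              length (filter (∁? P?) xs) ≤ length (filter P? xs)
  filter-∁-≤-filter-of-five xs len 3≤yes = ≤-trans no≤2 (≤-trans (n≤1+n 2) 3≤yes)
    where
    no≤2 : length (filter (∁? P?) xs) ≤ 2
    no≤2 = +-cancelˡ-≤ 3 _ 2 (≤-trans (+-monoˡ-≤ _ 3≤yes)
             (≤-reflexive (trans (length-filter+length-filter-∁ xs) len)))

module _ {A : Set} where

  private
    remove : ∀ {x : A} xs → x ∈ xs →
             ∃[ ys ] length xs ≡ suc (length ys) × (∀ {y} → y ∈ xs → y ≢ x → y ∈ ys)
    remove (_ ∷ xs) (here refl) = xs , refl , λ where
      (here refl) y≢x → contradiction refl y≢x
      (there y∈xs) _ → y∈xs
    remove (z ∷ xs) (there x∈xs) with remove xs x∈xs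
    ... | ys , len , keep = z ∷ ys , cong suc len , λ where
      (here refl) _ → here refl
      (there y∈xs) y≢x → there (keep y∈xs y≢x)

  unique-⊆⇒length-≤ : ∀ {xs ys : List A} → Unique xs → xs ⊆ ys → length xs ≤ length ys
  unique-⊆⇒length-≤ {[]} _ _ = z≤n
  unique-⊆⇒length-≤ {x ∷ xs} {ys} (x∉xs ∷ unique) xs⊆ys with remove ys (xs⊆ys (here refl))
  ... | zs , len , keep = subst (suc (length xs) ≤_) (sym len) (s≤s (unique-⊆⇒length-≤ unique xs⊆zs))
    where
    xs⊆zs : xs ⊆ zs
    xs⊆zs y∈xs = keep (xs⊆ys (there y∈xs)) λ { refl → lookup x∉xs y∈xs refl }

parity-even : ∀ {n} → 2 ∣ n → parity n ≡ 0ℙ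
parity-even (divides q refl) = trans (ℙ.*-homo-* q 2) (ℙ.*-zeroʳ (parity q))

parity-%-even : ∀ a {n} .{{_ : NonZero n}} → 2 ∣ n → parity (a % n) ≡ parity a
parity-%-even a {n} 2∣n = sym (begin
  parity a                              ≡⟨ cong parity (m≡m%n+[m/n]*n a n) ⟩
  parity (r + q * n)                    ≡⟨ ℙ.+-homo-+ r (q * n) ⟩
  parity r ℙ.+ parity (q * n)           ≡⟨ cong (parity r ℙ.+_) (ℙ.*-homo-* q n) ⟩
  parity r ℙ.+ (parity q ℙ.* parity n)  ≡⟨ cong (λ π → parity r ℙ.+ (parity q ℙ.* π)) (parity-even 2∣n) ⟩
  parity r ℙ.+ (parity q ℙ.* 0ℙ)        ≡⟨ cong (parity r ℙ.+_) (ℙ.*-zeroʳ (parity q)) ⟩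
  parity r ℙ.+ 0ℙ                       ≡⟨ ℙ.+-identityʳ (parity r) ⟩
  parity r                              ∎)
  where
  open ≡-Reasoning
  r = a % n
  q = a / n

parity-double : ∀ h → parity (h + h) ≡ 0ℙ
parity-double h = trans (ℙ.+-homo-+ h h) (ℙ.p+p≡0ℙ (parity h))

parity-double+1 : ∀ h → parity (suc (h + h)) ≡ 1ℙ
parity-double+1 h = trans (ℙ.+-homo-+ 1 (h + h)) (cong (1ℙ ℙ.+_) (parity-double h))

parity-∸ : ∀ {n b} → 2 ∣ n → b ≤ n → parity (n ∸ b) ≡ parity b
parity-∸ {n} {b} 2∣n b≤n = ℙ.+-cancelʳ-≡ (parity b) _ _ (begin
  parity (n ∸ b) ℙ.+ parity b   ≡⟨ ℙ.+-homo-+ (n ∸ b) b ⟨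
  parity (n ∸ b + b)            ≡⟨ cong parity (m∸n+n≡m b≤n) ⟩
  parity n                      ≡⟨ parity-even 2∣n ⟩
  0ℙ                            ≡⟨ ℙ.p+p≡0ℙ (parity b) ⟨
  parity b ℙ.+ parity b         ∎)
  where open ≡-Reasoning

even-or-odd : ∀ n → (∃[ h ] n ≡ h + h) ⊎ (∃[ h ] n ≡ suc (h + h))
even-or-odd 0 = inj₁ (0 , refl)
even-or-odd 1 = inj₂ (0 , refl)
even-or-odd (suc (suc n)) with even-or-odd n
... | inj₁ (h , n≡h+h) = inj₁ (suc h , trans (cong (suc ∘ suc) n≡h+h) (cong suc (sym (+-suc h h))))
... | inj₂ (h , n≡1+h+h) = inj₂ (suc h , trans (cong (suc ∘ suc) n≡1+h+h) (cong (suc ∘ suc) (sym (+-suc h h))))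

one-two-two : ∀ {a b c} → a ≤ 2 → b ≤ 2 → c ≤ 2 → a + b + c ≡ 5 →
              (a ≡ 1 × b ≡ 2 × c ≡ 2) ⊎ (a ≡ 2 × b ≡ 1 × c ≡ 2) ⊎ (a ≡ 2 × b ≡ 2 × c ≡ 1)
one-two-two (s≤s z≤n) (s≤s (s≤s z≤n)) _ refl = inj₁ (refl , refl , refl)
one-two-two (s≤s (s≤s z≤n)) (s≤s z≤n) _ refl = inj₂ (inj₁ (refl , refl , refl))
one-two-two (s≤s (s≤s z≤n)) (s≤s (s≤s z≤n)) _ refl = inj₂ (inj₂ (refl , refl , refl))
one-two-two z≤n z≤n (s≤s (s≤s ())) refl
one-two-two z≤n (s≤s z≤n) (s≤s (s≤s ())) refl
one-two-two z≤n (s≤s (s≤s z≤n)) (s≤s (s≤s ())) refl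
one-two-two (s≤s z≤n) z≤n (s≤s (s≤s ())) refl
one-two-two (s≤s z≤n) (s≤s z≤n) (s≤s (s≤s ())) refl
one-two-two (s≤s (s≤s z≤n)) z≤n (s≤s (s≤s ())) refl

≤2-sum≡5+2z⇒z≡0 : ∀ {a b c} z → a ≤ 2 → b ≤ 2 → c ≤ 2 → a + b + c ≡ 5 + 2 * z → z ≡ 0
≤2-sum≡5+2z⇒z≡0 zero _ _ _ _ = refl
≤2-sum≡5+2z⇒z≡0 {a} {b} {c} (suc z) a≤2 b≤2 c≤2 sum = contradiction (begin
  7              ≤⟨ +-monoʳ-≤ 5 (*-monoʳ-≤ 2 (s≤s (z≤n {z}))) ⟩
  5 + 2 * suc z  ≡⟨ sum ⟨
  a + b + c      ≤⟨ +-mono-≤ (+-mono-≤ a≤2 b≤2) c≤2 ⟩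
  6              ∎) (<-irrefl refl)
  where open ≤-Reasoning

infix 4 _≡_mod_
record _≡_mod_ (a b n : ℕ) .{{_ : NonZero n}} : Set where
  constructor mod-≡
  field %-≡ : a % n ≡ b % n
open _≡_mod_ public

module _ {n : ℕ} .{{_ : NonZero n}} where

  mod-refl : ∀ {a} → a ≡ a mod n
  mod-refl = mod-≡ refl

  mod-sym : ∀ {a b} → a ≡ b mod n → b ≡ a mod n
  mod-sym (mod-≡ e) = mod-≡ (sym e)

  mod-trans : ∀ {a b c} → a ≡ b mod n → b ≡ c mod n → a ≡ c mod n
  mod-trans (mod-≡ e) (mod-≡ f) = mod-≡ (trans e f)

  mod-setoid : Setoid _ _
  mod-setoid = record
    { Carrier = ℕ
    ; _≈_ = λ a b → a ≡ b mod n
    ; isEquivalence = record { refl = mod-refl ; sym = mod-sym ; trans = mod-trans }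
    }

  ≡⇒mod : ∀ {a b} → a ≡ b → a ≡ b mod n
  ≡⇒mod refl = mod-refl

  mod-dec : ∀ a b → Dec (a ≡ b mod n)
  mod-dec a b with a % n ≟ b % n
  ... | yes e = yes (mod-≡ e)
  ... | no e≢ = no λ { (mod-≡ e) → e≢ e }

  %-mod : ∀ a → a % n ≡ a mod n
  %-mod a = mod-≡ (m%n%n≡m%n a n)

  n≡0-mod : n ≡ 0 mod n
  n≡0-mod = mod-≡ (trans (n%n≡0 n) (sym (m<n⇒m%n≡m (>-nonZero⁻¹ n))))

  +-mod-cong : ∀ {a b c d} → a ≡ b mod n → c ≡ d mod n → a + c ≡ b + d mod n
  +-mod-cong {a} {b} {c} {d} (mod-≡ e) (mod-≡ f) = mod-≡ (begin
    (a + c) % n              ≡⟨ %-distribˡ-+ a c n ⟩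
    (a % n + c % n) % n      ≡⟨ cong₂ (λ u v → (u + v) % n) e f ⟩
    (b % n + d % n) % n      ≡⟨ %-distribˡ-+ b d n ⟨
    (b + d) % n              ∎)
    where open ≡-Reasoning

  ∸-%-mod-inverse : ∀ {a} → a ≤ n → (n ∸ a) % n + a ≡ 0 mod n
  ∸-%-mod-inverse {a} a≤n = mod-trans (+-mod-cong (%-mod (n ∸ a)) (mod-refl {a}))
                                      (mod-trans (≡⇒mod (m∸n+n≡m a≤n)) n≡0-mod)

  *-mod-congˡ : ∀ k {a b} → a ≡ b mod n → k * a ≡ k * b mod n
  *-mod-congˡ k {a} {b} (mod-≡ e) = mod-≡ (begin
    (k * a) % n              ≡⟨ %-distribˡ-* k a n ⟩
    (k % n * (a % n)) % n    ≡⟨ cong (λ u → (k % n * u) % n) e ⟩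
    (k % n * (b % n)) % n    ≡⟨ %-distribˡ-* k b n ⟨
    (k * b) % n              ∎)
    where open ≡-Reasoning

  +-mod-cancelʳ : ∀ {a b c} → a + c ≡ b + c mod n → a ≡ b mod n
  +-mod-cancelʳ {a} {b} {c} a+c≡b+c = begin
    a                    ≈⟨ ≡⇒mod (+-identityʳ a) ⟨
    a + 0                ≈⟨ +-mod-cong {a} mod-refl c+c⁻≡0 ⟨
    a + (c + c⁻)         ≡⟨ +-assoc a c c⁻ ⟨
    a + c + c⁻           ≈⟨ +-mod-cong a+c≡b+c (mod-refl {c⁻}) ⟩
    b + c + c⁻           ≡⟨ +-assoc b c c⁻ ⟩
    b + (c + c⁻)         ≈⟨ +-mod-cong {b} mod-refl c+c⁻≡0 ⟩
    b + 0                ≡⟨ +-identityʳ b ⟩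
    b                    ∎
    where
    open import Relation.Binary.Reasoning.Setoid mod-setoid
    c⁻ = n ∸ c % n
    c+c⁻≡0 : c + c⁻ ≡ 0 mod n
    c+c⁻≡0 = mod-trans (+-mod-cong (mod-sym (%-mod c)) (mod-refl {c⁻}))
               (mod-trans (≡⇒mod (m+[n∸m]≡n (<⇒≤ (m%n<n c n)))) n≡0-mod)

mod-injective-< : ∀ {n a b} .{{_ : NonZero n}} → a < n → b < n → a ≡ b mod n → a ≡ b
mod-injective-< a<n b<n (mod-≡ e) = trans (sym (m<n⇒m%n≡m a<n)) (trans e (m<n⇒m%n≡m b<n))

mod-weaken : ∀ {d n a b} .{{_ : NonZero d}} .{{_ : NonZero n}} → d ∣ n → a ≡ b mod n → a ≡ b mod d
mod-weaken {d} {n} {a} {b} d∣n (mod-≡ e) =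
  mod-≡ (trans (sym (m∣n⇒o%n%m≡o%m d n a d∣n)) (trans (cong (_% d) e) (m∣n⇒o%n%m≡o%m d n b d∣n)))

-- 2 is invertible modulo an odd modulus 2h+1, with inverse h+1.
double-mod-cancel : ∀ {n} .{{_ : NonZero n}} h → n ≡ suc (h + h) →
                    ∀ {a b} → a + a ≡ b + b mod n → a ≡ b mod n
double-mod-cancel h refl {a} {b} 2a≡2b =
  mod-trans (mod-sym (halve a)) (mod-trans (*-mod-congˡ (suc h) 2a≡2b) (halve b))
  where
  halve : ∀ a → suc h * (a + a) ≡ a mod suc (h + h)
  halve a = mod-≡ (trans (cong (_% suc (h + h)) (expand a h)) ([m+kn]%n≡m%n a a (suc (h + h))))
    where
    expand : ∀ a h → suc h * (a + a) ≡ a + a * suc (h + h)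
    expand = solve-∀

lowHalf : ℕ → Bool
lowHalf y = does (y % 4 <? 2)

lowHalf-cong : ∀ {y y′} → y ≡ y′ mod 4 → lowHalf y ≡ lowHalf y′
lowHalf-cong (mod-≡ e) = cong (λ r → does (r <? 2)) e

-- OddPair (d % 4) (d′ % 4) says that d is odd and d′ ≡ -d (mod 4).
data OddPair : ℕ → ℕ → Set where
  one   : OddPair 1 3
  three : OddPair 3 1

odd-pair : ∀ d d′ → parity d ≡ 1ℙ → d + d′ ≡ 0 mod 4 → OddPair (d % 4) (d′ % 4)
odd-pair d d′ odd (mod-≡ sum) = residues (d % 4) (d′ % 4) (m%n<n d 4) (m%n<n d′ 4)
  (trans (parity-%-even d (divides 2 refl)) odd) (trans (sym (%-distribˡ-+ d d′ 4)) sum)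
  where
  residues : ∀ e e′ → e < 4 → e′ < 4 → parity e ≡ 1ℙ → (e + e′) % 4 ≡ 0 → OddPair e e′
  residues 1 3 _ _ _ _ = one
  residues 3 1 _ _ _ _ = three
  residues (suc (suc (suc (suc _)))) _ (s≤s (s≤s (s≤s (s≤s ())))) _ _ _
  residues _ (suc (suc (suc (suc _)))) _ (s≤s (s≤s (s≤s (s≤s ())))) _ _

half-step : ∀ {e e′} r → r < 4 → OddPair e e′ →
            lowHalf (r + e) ≡ lowHalf r ⊎ lowHalf (r + e′) ≡ lowHalf r
half-step 0 _ one = inj₁ refl
half-step 1 _ one = inj₂ refl
half-step 2 _ one = inj₁ refl
half-step 3 _ one = inj₂ refl
half-step 0 _ three = inj₂ refl
half-step 1 _ three = inj₁ refl
half-step 2 _ three = inj₂ refl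
half-step 3 _ three = inj₁ refl
half-step (suc (suc (suc (suc _)))) (s≤s (s≤s (s≤s (s≤s ())))) _

one-step-keeps-half : ∀ {y u u′} d d′ → u ≡ y + d mod 4 → u′ ≡ y + d′ mod 4 → parity d ≡ 1ℙ →
                      d + d′ ≡ 0 mod 4 → lowHalf u ≡ lowHalf y ⊎ lowHalf u′ ≡ lowHalf y
one-step-keeps-half {y} d d′ u≡y+d u′≡y+d′ d-odd d+d′≡0 =
  Sum.map (reduce d u≡y+d) (reduce d′ u′≡y+d′)
          (half-step (y % 4) (m%n<n y 4) (odd-pair d d′ d-odd d+d′≡0))
  where
  reduce : ∀ {u} e → u ≡ y + e mod 4 → lowHalf (y % 4 + e % 4) ≡ lowHalf (y % 4) →
           lowHalf u ≡ lowHalf y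
  reduce {u} e u≡y+e kept = begin
    lowHalf u                  ≡⟨ lowHalf-cong (mod-trans u≡y+e (mod-sym (+-mod-cong (%-mod y) (%-mod e)))) ⟩
    lowHalf (y % 4 + e % 4)    ≡⟨ kept ⟩
    lowHalf (y % 4)            ≡⟨ lowHalf-cong (%-mod y) ⟩
    lowHalf y                  ∎
    where open ≡-Reasoning

-- A square in ℤ₂ × ℤₙ, n odd

data Letter : Set where
  𝔞 𝔟 : Letter

Move : Set
Move = Letter × Sign

-- A backward step is stated as u + d ≡ t, avoiding truncated subtraction.
Step : ∀ n .{{_ : NonZero n}} → Sign → ℕ → ℕ → ℕ → Set
Step n Sign.+ d t u = u ≡ t + d mod n
Step n Sign.- d t u = u + d ≡ t mod n

Step-weaken : ∀ {d n} .{{_ : NonZero d}} .{{_ : NonZero n}} → d ∣ n →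
              ∀ s {δ t u} → Step n s δ t u → Step d s δ t u
Step-weaken d∣n Sign.+ = mod-weaken d∣n
Step-weaken d∣n Sign.- = mod-weaken d∣n

record TwoMoves (Keeps : Move → Set) : Set where
  constructor twoMoves
  field
    {first second} : Move
    first≢second : first ≢ second
    keeps-first : Keeps first
    keeps-second : Keeps second

one-from-each : ∀ {Keeps : Move → Set} μ₁ μ₂ ν₁ ν₂ →
                μ₁ ≢ ν₁ → μ₁ ≢ ν₂ → μ₂ ≢ ν₁ → μ₂ ≢ ν₂ →
                Keeps μ₁ ⊎ Keeps μ₂ → Keeps ν₁ ⊎ Keeps ν₂ → TwoMoves Keeps
one-from-each _ _ _ _ d₁₁ _ _ _ (inj₁ k) (inj₁ k′) = twoMoves d₁₁ k k′
one-from-each _ _ _ _ _ d₁₂ _ _ (inj₁ k) (inj₂ k′) = twoMoves d₁₂ k k′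
one-from-each _ _ _ _ _ _ d₂₁ _ (inj₂ k) (inj₁ k′) = twoMoves d₂₁ k k′
one-from-each _ _ _ _ _ _ _ d₂₂ (inj₂ k) (inj₂ k′) = twoMoves d₂₂ k k′

-- Positions (ε , t) ∈ ℤ₂ × ℤₙ move by ±(1, α) and ±(1, β); the corners of the square
-- (0, 0) — (1, α) — (0, α + β) — (1, β) form one side of a colouring in which each position
-- keeps two of its four moves on its own side.
module Square {n : ℕ} .{{_ : NonZero n}} (halve : ∀ {a b} → a + a ≡ b + b mod n → a ≡ b mod n)
              (α β : ℕ) where

  open import Relation.Binary.Reasoning.Setoid (mod-setoid {n})

  size : Letter → ℕ
  size 𝔞 = α
  size 𝔟 = β

  Corner : Parity → ℕ → Set
  Corner 0ℙ t = t ≡ 0 mod n ⊎ t ≡ α + β mod n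
  Corner 1ℙ t = t ≡ α mod n ⊎ t ≡ β mod n

  Corner-resp : ∀ ε {t t′} → t ≡ t′ mod n → Corner ε t → Corner ε t′
  Corner-resp 0ℙ t≡t′ = Sum.map (mod-trans (mod-sym t≡t′)) (mod-trans (mod-sym t≡t′))
  Corner-resp 1ℙ t≡t′ = Sum.map (mod-trans (mod-sym t≡t′)) (mod-trans (mod-sym t≡t′))

  Corner? : ∀ ε t → Dec (Corner ε t)
  Corner? 0ℙ t = mod-dec t 0 ⊎-dec mod-dec t (α + β)
  Corner? 1ℙ t = mod-dec t α ⊎-dec mod-dec t β

  onSquare : Parity → ℕ → Bool
  onSquare ε t = does (Corner? ε t)

  onSquare-cong : ∀ ε {t t′} → t ≡ t′ mod n → onSquare ε t ≡ onSquare ε t′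
  onSquare-cong ε {t} {t′} t≡t′ with Corner? ε t | Corner? ε t′
  ... | yes _ | yes _ = refl
  ... | no _ | no _ = refl
  ... | yes c | no ¬c′ = contradiction (Corner-resp ε t≡t′ c) ¬c′
  ... | no ¬c | yes c′ = contradiction (Corner-resp ε (mod-sym t≡t′) c′) ¬c

  Keeps : Parity → ℕ → (Move → ℕ) → Move → Set
  Keeps ε t u μ = onSquare (ε ℙ.⁻¹) (u μ) ≡ onSquare ε t

  private
    both-on : ∀ ε′ ε {u t} → Corner ε′ u → Corner ε t → onSquare ε′ u ≡ onSquare ε t
    both-on ε′ ε {u} {t} cu ct = trans (dec-true (Corner? ε′ u) cu) (sym (dec-true (Corner? ε t) ct))

    both-off : ∀ ε′ ε {u t} → ¬ Corner ε′ u → ¬ Corner ε t → onSquare ε′ u ≡ onSquare ε t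
    both-off ε′ ε {u} {t} cu ct = trans (dec-false (Corner? ε′ u) cu) (sym (dec-false (Corner? ε t) ct))

    one-off : ∀ ε {u₁ u₂} → ¬ (Corner ε u₁ × Corner ε u₂) → ¬ Corner ε u₁ ⊎ ¬ Corner ε u₂
    one-off ε {u₁} both with Corner? ε u₁
    ... | no ¬c₁ = inj₁ ¬c₁
    ... | yes c₁ = inj₂ λ c₂ → both (c₁ , c₂)

    forward : ∀ {u t d e} → u ≡ t + d mod n → t ≡ e mod n → u ≡ e + d mod n
    forward u≡t+d t≡e = mod-trans u≡t+d (+-mod-cong t≡e mod-refl)

    backward : ∀ {u t d e} → u + d ≡ t mod n → t ≡ e + d mod n → u ≡ e mod n
    backward u+d≡t t≡e+d = +-mod-cancelʳ (mod-trans u+d≡t t≡e+d)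

    β+α→α+β : ∀ {u} → u ≡ β + α mod n → u ≡ α + β mod n
    β+α→α+β u≡β+α = mod-trans u≡β+α (≡⇒mod (+-comm β α))

    α+β→β+α : ∀ {u} → u ≡ α + β mod n → u ≡ β + α mod n
    α+β→β+α u≡α+β = mod-trans u≡α+β (≡⇒mod (+-comm α β))

    -- Off the square, certain pairs of neighbours are never both corners, as 2 is invertible.
    ahead-off : ∀ {t u₁ u₂} → ¬ t ≡ 0 mod n → u₁ ≡ t + α mod n → u₂ ≡ t + β mod n →
                ¬ (Corner 1ℙ u₁ × Corner 1ℙ u₂)
    ahead-off t≢0 u₁≡ _ (inj₁ u₁≡α , _) = t≢0 (+-mod-cancelʳ (mod-trans (mod-sym u₁≡) u₁≡α))
    ahead-off t≢0 _ u₂≡ (_ , inj₂ u₂≡β) = t≢0 (+-mod-cancelʳ (mod-trans (mod-sym u₂≡) u₂≡β))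
    ahead-off {t} {u₁} {u₂} t≢0 u₁≡ u₂≡ (inj₂ u₁≡β , inj₁ u₂≡α) = t≢0 (halve (+-mod-cancelʳ (begin
      t + t + (α + β)      ≡⟨ +-rearrange t t α β ⟩
      (t + α) + (t + β)    ≈⟨ +-mod-cong (mod-sym u₁≡) (mod-sym u₂≡) ⟩
      u₁ + u₂              ≈⟨ +-mod-cong u₁≡β u₂≡α ⟩
      β + α                ≡⟨ +-comm β α ⟩
      0 + 0 + (α + β)      ∎)))
      where
      +-rearrange : ∀ a b c d → a + b + (c + d) ≡ (a + c) + (b + d)
      +-rearrange = solve-∀

    behind-off : ∀ {t u₁ u₂} → ¬ t ≡ α + β mod n → u₁ + α ≡ t mod n → u₂ + β ≡ t mod n →
                 ¬ (Corner 1ℙ u₁ × Corner 1ℙ u₂)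
    behind-off t≢ u₁+α≡t _ (inj₂ u₁≡β , _) = t≢ (β+α→α+β (mod-trans (mod-sym u₁+α≡t) (+-mod-cong u₁≡β mod-refl)))
    behind-off t≢ _ u₂+β≡t (_ , inj₁ u₂≡α) = t≢ (mod-trans (mod-sym u₂+β≡t) (+-mod-cong u₂≡α mod-refl))
    behind-off {t} {u₁} {u₂} t≢ u₁+α≡t u₂+β≡t (inj₁ u₁≡α , inj₂ u₂≡β) = t≢ (begin
      t          ≈⟨ t≡2α ⟩
      α + α      ≈⟨ +-mod-cong {a = α} mod-refl α≡β ⟩
      α + β      ∎)
      where
      t≡2α : t ≡ α + α mod n
      t≡2α = mod-trans (mod-sym u₁+α≡t) (+-mod-cong u₁≡α mod-refl)
      α≡β : α ≡ β mod n
      α≡β = halve (mod-trans (mod-sym t≡2α) (mod-trans (mod-sym u₂+β≡t) (+-mod-cong u₂≡β mod-refl)))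

    zero-sum : ∀ {t u} γ δ → t ≡ (α + β) + γ mod n → u ≡ t + δ mod n → u ≡ 0 mod n →
               γ + δ ≡ α + β mod n → α + β ≡ 0 mod n
    zero-sum {t} {u} γ δ t≡ u≡ u≡0 γ+δ≡ = halve (begin
      (α + β) + (α + β)        ≈⟨ +-mod-cong {a = α + β} mod-refl (mod-sym γ+δ≡) ⟩
      (α + β) + (γ + δ)        ≡⟨ +-assoc (α + β) γ δ ⟨
      (α + β) + γ + δ          ≈⟨ +-mod-cong (mod-sym t≡) (mod-refl {a = δ}) ⟩
      t + δ                    ≈⟨ mod-sym u≡ ⟩
      u                        ≈⟨ u≡0 ⟩
      0 + 0                    ∎)

    ahead-behind-off : ∀ {t u₁ u₂} → ¬ t ≡ β mod n → u₁ ≡ t + α mod n → u₂ + β ≡ t mod n →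
                       ¬ (Corner 0ℙ u₁ × Corner 0ℙ u₂)
    ahead-behind-off t≢β u₁≡ _ (inj₂ u₁≡α+β , _) = t≢β (+-mod-cancelʳ (mod-trans (mod-sym u₁≡) (α+β→β+α u₁≡α+β)))
    ahead-behind-off t≢β _ u₂+β≡t (_ , inj₁ u₂≡0) = t≢β (mod-trans (mod-sym u₂+β≡t) (+-mod-cong u₂≡0 mod-refl))
    ahead-behind-off {t} t≢β u₁≡ u₂+β≡t (inj₁ u₁≡0 , inj₂ u₂≡α+β) = t≢β (begin
      t                  ≈⟨ t≡ ⟩
      (α + β) + β        ≈⟨ +-mod-cong (zero-sum β α t≡ u₁≡ u₁≡0 (≡⇒mod (+-comm β α))) (mod-refl {a = β}) ⟩
      0 + β              ∎)
      where
      t≡ : t ≡ (α + β) + β mod n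
      t≡ = mod-trans (mod-sym u₂+β≡t) (+-mod-cong u₂≡α+β mod-refl)

    behind-ahead-off : ∀ {t u₁ u₂} → ¬ t ≡ α mod n → u₁ + α ≡ t mod n → u₂ ≡ t + β mod n →
                       ¬ (Corner 0ℙ u₁ × Corner 0ℙ u₂)
    behind-ahead-off t≢α u₁+α≡t _ (inj₁ u₁≡0 , _) = t≢α (mod-trans (mod-sym u₁+α≡t) (+-mod-cong u₁≡0 mod-refl))
    behind-ahead-off t≢α _ u₂≡ (_ , inj₂ u₂≡α+β) = t≢α (+-mod-cancelʳ (mod-trans (mod-sym u₂≡) u₂≡α+β))
    behind-ahead-off {t} t≢α u₁+α≡t u₂≡ (inj₂ u₁≡α+β , inj₁ u₂≡0) = t≢α (begin
      t                  ≈⟨ t≡ ⟩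
      (α + β) + α        ≈⟨ +-mod-cong (zero-sum α β t≡ u₂≡ u₂≡0 mod-refl) (mod-refl {a = α}) ⟩
      0 + α              ∎)
      where
      t≡ : t ≡ (α + β) + α mod n
      t≡ = mod-trans (mod-sym u₁+α≡t) (+-mod-cong u₁≡α+β mod-refl)

  square-keeps-two : ∀ ε t (u : Move → ℕ) → (∀ ℓ s → Step n s (size ℓ) t (u (ℓ , s))) →
                     TwoMoves (Keeps ε t u)
  square-keeps-two 0ℙ t u step = case Corner? 0ℙ t of λ where
    (yes (inj₁ t≡0)) → record
      { first = 𝔞 , Sign.+ ; second = 𝔟 , Sign.+ ; first≢second = λ ()
      ; keeps-first = both-on 1ℙ 0ℙ (inj₁ (forward (step 𝔞 Sign.+) t≡0)) (inj₁ t≡0)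
      ; keeps-second = both-on 1ℙ 0ℙ (inj₂ (forward (step 𝔟 Sign.+) t≡0)) (inj₁ t≡0)
      }
    (yes (inj₂ t≡α+β)) → record
      { first = 𝔞 , Sign.- ; second = 𝔟 , Sign.- ; first≢second = λ ()
      ; keeps-first = both-on 1ℙ 0ℙ (inj₂ (backward (step 𝔞 Sign.-) (α+β→β+α t≡α+β))) (inj₂ t≡α+β)
      ; keeps-second = both-on 1ℙ 0ℙ (inj₁ (backward (step 𝔟 Sign.-) t≡α+β)) (inj₂ t≡α+β)
      }
    (no t-off) → one-from-each (𝔞 , Sign.+) (𝔟 , Sign.+) (𝔞 , Sign.-) (𝔟 , Sign.-) (λ ()) (λ ()) (λ ()) (λ ())
      (Sum.map (λ off → both-off 1ℙ 0ℙ off t-off) (λ off → both-off 1ℙ 0ℙ off t-off)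
        (one-off 1ℙ (ahead-off (t-off ∘ inj₁) (step 𝔞 Sign.+) (step 𝔟 Sign.+))))
      (Sum.map (λ off → both-off 1ℙ 0ℙ off t-off) (λ off → both-off 1ℙ 0ℙ off t-off)
        (one-off 1ℙ (behind-off (t-off ∘ inj₂) (step 𝔞 Sign.-) (step 𝔟 Sign.-))))
  square-keeps-two 1ℙ t u step = case Corner? 1ℙ t of λ where
    (yes (inj₁ t≡α)) → record
      { first = 𝔞 , Sign.- ; second = 𝔟 , Sign.+ ; first≢second = λ ()
      ; keeps-first = both-on 0ℙ 1ℙ (inj₁ (backward (step 𝔞 Sign.-) t≡α)) (inj₁ t≡α)
      ; keeps-second = both-on 0ℙ 1ℙ (inj₂ (forward (step 𝔟 Sign.+) t≡α)) (inj₁ t≡α)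
      }
    (yes (inj₂ t≡β)) → record
      { first = 𝔞 , Sign.+ ; second = 𝔟 , Sign.- ; first≢second = λ ()
      ; keeps-first = both-on 0ℙ 1ℙ (inj₂ (β+α→α+β (forward (step 𝔞 Sign.+) t≡β))) (inj₂ t≡β)
      ; keeps-second = both-on 0ℙ 1ℙ (inj₁ (backward (step 𝔟 Sign.-) t≡β)) (inj₂ t≡β)
      }
    (no t-off) → one-from-each (𝔞 , Sign.+) (𝔟 , Sign.-) (𝔞 , Sign.-) (𝔟 , Sign.+) (λ ()) (λ ()) (λ ()) (λ ())
      (Sum.map (λ off → both-off 0ℙ 1ℙ off t-off) (λ off → both-off 0ℙ 1ℙ off t-off)
        (one-off 0ℙ (ahead-behind-off (t-off ∘ inj₂) (step 𝔞 Sign.+) (step 𝔟 Sign.-))))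
      (Sum.map (λ off → both-off 0ℙ 1ℙ off t-off) (λ off → both-off 0ℙ 1ℙ off t-off)
        (one-off 0ℙ (behind-ahead-off (t-off ∘ inj₁) (step 𝔞 Sign.-) (step 𝔟 Sign.+))))

-- The Klein four-group and its characters

Klein : Set
Klein = Parity × Parity

infixl 6 _+ᴷ_
_+ᴷ_ : Klein → Klein → Klein
(a , b) +ᴷ (c , d) = a ℙ.+ c , b ℙ.+ d

0ᴷ : Klein
0ᴷ = 0ℙ , 0ℙ

_≟ᴷ_ : DecidableEquality Klein
_≟ᴷ_ = ≡-dec ℙ._≟_ ℙ._≟_

data Character : Set where
  χ₁ χ₂ χ₃ : Character

infix 8 _·_
_·_ : Character → Klein → Parity
χ₁ · (a , b) = a
χ₂ · (a , b) = b
χ₃ · (a , b) = a ℙ.+ b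

·-homo : ∀ k v w → k · (v +ᴷ w) ≡ k · v ℙ.+ k · w
·-homo χ₁ v w = refl
·-homo χ₂ v w = refl
·-homo χ₃ (a , b) (c , d) = interchange a c b d

·-0ᴷ : ∀ k → k · 0ᴷ ≡ 0ℙ
·-0ᴷ χ₁ = refl
·-0ᴷ χ₂ = refl
·-0ᴷ χ₃ = refl

kernelComplement : Character → Klein
kernelComplement χ₁ = 1ℙ , 0ℙ
kernelComplement χ₂ = 0ℙ , 1ℙ
kernelComplement χ₃ = 1ℙ , 0ℙ

·-kernelComplement : ∀ k → k · kernelComplement k ≡ 1ℙ
·-kernelComplement χ₁ = refl
·-kernelComplement χ₂ = refl
·-kernelComplement χ₃ = refl

kernelGenerator : Character → Klein
kernelGenerator χ₁ = 0ℙ , 1ℙ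
kernelGenerator χ₂ = 1ℙ , 0ℙ
kernelGenerator χ₃ = 1ℙ , 1ℙ

kernel≡generator : ∀ k {v} → k · v ≡ 0ℙ → v ≢ 0ᴷ → v ≡ kernelGenerator k
kernel≡generator χ₁ {0ℙ , 0ℙ} _ v≢0 = contradiction refl v≢0
kernel≡generator χ₁ {0ℙ , 1ℙ} _ _ = refl
kernel≡generator χ₂ {0ℙ , 0ℙ} _ v≢0 = contradiction refl v≢0
kernel≡generator χ₂ {1ℙ , 0ℙ} _ _ = refl
kernel≡generator χ₃ {0ℙ , 0ℙ} _ v≢0 = contradiction refl v≢0
kernel≡generator χ₃ {1ℙ , 1ℙ} _ _ = refl

kernelGenerator-injective : ∀ {k k′} → kernelGenerator k ≡ kernelGenerator k′ → k ≡ k′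
kernelGenerator-injective {χ₁} {χ₁} refl = refl
kernelGenerator-injective {χ₂} {χ₂} refl = refl
kernelGenerator-injective {χ₃} {χ₃} refl = refl

second-kernelGenerator : ∀ k → proj₂ (kernelGenerator k) ≡ 0ℙ → k ≡ χ₂
second-kernelGenerator χ₂ _ = refl

second-kernelGenerator-≢χ₂ : ∀ k → k ≢ χ₂ → proj₂ (kernelGenerator k) ≡ 1ℙ
second-kernelGenerator-≢χ₂ χ₁ _ = refl
second-kernelGenerator-≢χ₂ χ₂ k≢χ₂ = contradiction refl k≢χ₂
second-kernelGenerator-≢χ₂ χ₃ _ = refl

kernelCount : Character → List Klein → ℕ
kernelCount k vs = length (filter (λ v → k · v ℙ.≟ 0ℙ) vs)

zeroCount : List Klein → ℕ
zeroCount vs = length (filter (_≟ᴷ 0ᴷ) vs)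

-- 0ᴷ lies in all three kernels, every other vector in exactly one.
kernelCount-sum : ∀ vs → kernelCount χ₁ vs + kernelCount χ₂ vs + kernelCount χ₃ vs ≡
                        length vs + 2 * zeroCount vs
kernelCount-sum [] = refl
kernelCount-sum ((0ℙ , 0ℙ) ∷ vs) = begin
  suc a + suc b + suc c    ≡⟨ shift a b c ⟩
  3 + (a + b + c)          ≡⟨ cong (3 +_) (kernelCount-sum vs) ⟩
  3 + (length vs + 2 * z)  ≡⟨ unshift (length vs) z ⟩
  suc (length vs) + 2 * suc z ∎
  where
  open ≡-Reasoning
  a = kernelCount χ₁ vs
  b = kernelCount χ₂ vs
  c = kernelCount χ₃ vs
  z = zeroCount vs
  shift : ∀ a b c → suc a + suc b + suc c ≡ 3 + (a + b + c)
  shift = solve-∀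
  unshift : ∀ l z → 3 + (l + 2 * z) ≡ suc l + 2 * suc z
  unshift = solve-∀
kernelCount-sum ((0ℙ , 1ℙ) ∷ vs) = cong suc (kernelCount-sum vs)
kernelCount-sum ((1ℙ , 0ℙ) ∷ vs) =
  trans (cong (_+ kernelCount χ₃ vs) (+-suc (kernelCount χ₁ vs) (kernelCount χ₂ vs)))
        (cong suc (kernelCount-sum vs))
kernelCount-sum ((1ℙ , 1ℙ) ∷ vs) = trans (+-suc _ _) (cong suc (kernelCount-sum vs))

-- The group ℤ₂ × ℤ₂ₚ

module ℤ₂×ℤ₂ₚ (p : ℕ) (1<p : 1 < p) where

  m : ℕ
  m = 2 * p

  instance
    m≢0 : NonZero m
    m≢0 = 2p≢0 1<p
    p≢0 : NonZero p
    p≢0 = >-nonZero (<-trans z<s 1<p)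

  2∣m : 2 ∣ m
  2∣m = divides p (*-comm 2 p)

  p∣m : p ∣ m
  p∣m = divides 2 refl

  G : Set
  G = Z2xZ m

  infixl 6 _⊕ₘ_
  _⊕ₘ_ : G → G → G
  _⊕ₘ_ = _⊕_ m

  ⊖ₘ_ : G → G
  ⊖ₘ_ = ⊖_ m

  𝟘ₘ : G
  𝟘ₘ = 𝟘 m

  infix 4 _≟ᴳ_
  _≟ᴳ_ : DecidableEquality G
  _≟ᴳ_ = ≡-dec Fin._≟_ Fin._≟_

  x₁ x₂ : G → ℕ
  x₁ x = toℕ (proj₁ x)
  x₂ x = toℕ (proj₂ x)

  x₁-⊕ : ∀ x s → x₁ (x ⊕ₘ s) ≡ (x₁ x + x₁ s) % 2
  x₁-⊕ x s = toℕ-fromℕ< _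

  x₂-⊕ : ∀ x s → x₂ (x ⊕ₘ s) ≡ (x₂ x + x₂ s) % m
  x₂-⊕ x s = toℕ-fromℕ< _

  x₁-⊖ : ∀ s → x₁ (⊖ₘ s) ≡ (2 ∸ x₁ s) % 2
  x₁-⊖ s = toℕ-fromℕ< _

  x₂-⊖ : ∀ s → x₂ (⊖ₘ s) ≡ (m ∸ x₂ s) % m
  x₂-⊖ s = toℕ-fromℕ< _

  x₂-𝟘 : x₂ 𝟘ₘ ≡ 0
  x₂-𝟘 = trans (toℕ-fromℕ< _) (m<n⇒m%n≡m (>-nonZero⁻¹ m))

  x₁-⊕-mod : ∀ x s → x₁ (x ⊕ₘ s) ≡ x₁ x + x₁ s mod 2
  x₁-⊕-mod x s = mod-trans (≡⇒mod (x₁-⊕ x s)) (%-mod _)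

  x₂-⊕-mod : ∀ x s → x₂ (x ⊕ₘ s) ≡ x₂ x + x₂ s mod m
  x₂-⊕-mod x s = mod-trans (≡⇒mod (x₂-⊕ x s)) (%-mod _)

  x₁-⊖-mod : ∀ s → x₁ (⊖ₘ s) + x₁ s ≡ 0 mod 2
  x₁-⊖-mod s = mod-trans (≡⇒mod (cong (_+ x₁ s) (x₁-⊖ s))) (∸-%-mod-inverse (<⇒≤ (toℕ<n (proj₁ s))))

  x₂-⊖-mod : ∀ s → x₂ (⊖ₘ s) + x₂ s ≡ 0 mod m
  x₂-⊖-mod s = mod-trans (≡⇒mod (cong (_+ x₂ s) (x₂-⊖ s))) (∸-%-mod-inverse (<⇒≤ (toℕ<n (proj₂ s))))

  κ : G → Klein
  κ x = parity (x₁ x) , parity (x₂ x)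

  κ-⊕ : ∀ x s → κ (x ⊕ₘ s) ≡ κ x +ᴷ κ s
  κ-⊕ x s = cong₂ _,_ (parity-homo (x₁ x) (x₁ s) (x₁-⊕ x s) (divides 1 refl))
                      (parity-homo (x₂ x) (x₂ s) (x₂-⊕ x s) 2∣m)
    where
    parity-homo : ∀ a b {c n} .{{_ : NonZero n}} → c ≡ (a + b) % n → 2 ∣ n → parity c ≡ parity a ℙ.+ parity b
    parity-homo a b refl 2∣n = trans (parity-%-even (a + b) 2∣n) (ℙ.+-homo-+ a b)

  κ-⊖ : ∀ s → κ (⊖ₘ s) ≡ κ s
  κ-⊖ s = cong₂ _,_ (parity-neg (x₁ s) (x₁-⊖ s) (divides 1 refl) (toℕ<n (proj₁ s)))
                    (parity-neg (x₂ s) (x₂-⊖ s) 2∣m (toℕ<n (proj₂ s)))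
    where
    parity-neg : ∀ a {c n} .{{_ : NonZero n}} → c ≡ (n ∸ a) % n → 2 ∣ n → a < n → parity c ≡ parity a
    parity-neg a {n = n} refl 2∣n a<n = trans (parity-%-even (n ∸ a) 2∣n) (parity-∸ 2∣n (<⇒≤ a<n))

  κ-𝟘 : κ 𝟘ₘ ≡ 0ᴷ
  κ-𝟘 = cong (λ t → 0ℙ , parity t) x₂-𝟘

  κ-surjective : ∀ v → ∃[ x ] κ x ≡ v
  κ-surjective (a , b) = (bit₁ a , bit₂ b) , cong₂ _,_ (parity-bit₁ a) (parity-bit₂ b)
    where
    1<m : 1 < m
    1<m = ≤-trans 1<p (m≤n*m p 2)
    bit₁ : Parity → Fin 2
    bit₁ 0ℙ = Fin.zero
    bit₁ 1ℙ = Fin.suc Fin.zero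
    bit₂ : Parity → Fin m
    bit₂ 0ℙ = proj₂ 𝟘ₘ
    bit₂ 1ℙ = Fin.fromℕ< 1<m
    parity-bit₁ : ∀ a → parity (toℕ (bit₁ a)) ≡ a
    parity-bit₁ 0ℙ = refl
    parity-bit₁ 1ℙ = refl
    parity-bit₂ : ∀ b → parity (toℕ (bit₂ b)) ≡ b
    parity-bit₂ 0ℙ = cong parity x₂-𝟘
    parity-bit₂ 1ℙ = cong parity (toℕ-fromℕ< 1<m)

  2<m : 2 < m
  2<m = ≤-trans (s≤s (s≤s (s≤s z≤n))) (*-monoʳ-≤ 2 1<p)

  point : ∀ t → t < m → G
  point t t<m = Fin.zero , Fin.fromℕ< t<m

  x₂-point : ∀ t (t<m : t < m) → x₂ (point t t<m) ≡ t
  x₂-point t t<m = toℕ-fromℕ< t<m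

  κ-point : ∀ t (t<m : t < m) → κ (point t t<m) ≡ (0ℙ , parity t)
  κ-point t t<m = cong (λ u → 0ℙ , parity u) (x₂-point t t<m)

  signed : Sign → G → G
  signed Sign.+ y = y
  signed Sign.- y = ⊖ₘ y

  x₂-signed-step : ∀ s x y → Step m s (x₂ y) (x₂ x) (x₂ (x ⊕ₘ signed s y))
  x₂-signed-step Sign.+ x y = x₂-⊕-mod x y
  x₂-signed-step Sign.- x y = begin
    x₂ (x ⊕ₘ ⊖ₘ y) + x₂ y          ≈⟨ +-mod-cong (x₂-⊕-mod x (⊖ₘ y)) (mod-refl {a = x₂ y}) ⟩
    x₂ x + x₂ (⊖ₘ y) + x₂ y        ≡⟨ +-assoc (x₂ x) (x₂ (⊖ₘ y)) (x₂ y) ⟩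
    x₂ x + (x₂ (⊖ₘ y) + x₂ y)      ≈⟨ +-mod-cong (mod-refl {a = x₂ x}) (x₂-⊖-mod y) ⟩
    x₂ x + 0                       ≡⟨ +-identityʳ (x₂ x) ⟩
    x₂ x                           ∎
    where open import Relation.Binary.Reasoning.Setoid (mod-setoid {m})

  count : Character → List G → ℕ
  count k S = kernelCount k (map κ S)

  InKernel : Character → G → Set
  InKernel k s = k · κ s ≡ 0ℙ

  InKernel? : ∀ k → Decidable (InKernel k)
  InKernel? k s = k · κ s ℙ.≟ 0ℙ

  filter-InKernel : ∀ k S → length (filter (InKernel? k) S) ≡ count k S
  filter-InKernel k S = sym (length-filter-map (λ v → k · v ℙ.≟ 0ℙ) κ S)

  InKernel-⊖ : ∀ k {s} → InKernel k s → InKernel k (⊖ₘ s)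
  InKernel-⊖ k {s} = subst (λ v → k · v ≡ 0ℙ) (sym (κ-⊖ s))

  ·κ-⊕-InKernel : ∀ k {s} x → InKernel k s → k · κ (x ⊕ₘ s) ≡ k · κ x
  ·κ-⊕-InKernel k {s} x s∈ker = begin
    k · κ (x ⊕ₘ s)         ≡⟨ cong (k ·_) (κ-⊕ x s) ⟩
    k · (κ x +ᴷ κ s)       ≡⟨ ·-homo k (κ x) (κ s) ⟩
    k · κ x ℙ.+ k · κ s    ≡⟨ cong (k · κ x ℙ.+_) s∈ker ⟩
    k · κ x ℙ.+ 0ℙ         ≡⟨ ℙ.+-identityʳ (k · κ x) ⟩
    k · κ x                ∎
    where open ≡-Reasoning

  involution-x₂ : ∀ x → ⊖ₘ x ≡ x → x₂ x ≡ 0 ⊎ x₂ x ≡ p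
  involution-x₂ x ⊖x≡x = go (x₂ x) (toℕ<n (proj₂ x)) (trans (sym (x₂-⊖ x)) (cong x₂ ⊖x≡x))
    where
    go : ∀ t → t < m → (m ∸ t) % m ≡ t → t ≡ 0 ⊎ t ≡ p
    go zero _ _ = inj₁ refl
    go (suc t) t<m e = inj₂ (*-cancelˡ-≡ (suc t) p 2 (begin
      2 * suc t                 ≡⟨ cong (suc t +_) (+-identityʳ (suc t)) ⟩
      suc t + suc t             ≡⟨ cong (_+ suc t) m∸t≡t ⟨
      (m ∸ suc t) + suc t       ≡⟨ m∸n+n≡m (<⇒≤ t<m) ⟩
      m                         ∎))
      where
      open ≡-Reasoning
      m∸t≡t : m ∸ suc t ≡ suc t
      m∸t≡t = trans (sym (m<n⇒m%n≡m (∸-monoʳ-< {m} {suc t} {0} z<s (<⇒≤ t<m)))) e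

  fromParity : Parity → ℕ
  fromParity 0ℙ = 0
  fromParity 1ℙ = 1

  x₁≡fromParity : ∀ x → x₁ x ≡ fromParity (parity (x₁ x))
  x₁≡fromParity (Fin.zero , _) = refl
  x₁≡fromParity (Fin.suc Fin.zero , _) = refl

  involution-determined-by-κ : parity p ≡ 1ℙ → ∀ {u v} → ⊖ₘ u ≡ u → ⊖ₘ v ≡ v → κ u ≡ κ v → u ≡ v
  involution-determined-by-κ p-odd {u} {v} ⊖u≡u ⊖v≡v κu≡κv =
    ×-≡,≡→≡ (toℕ-injective x₁u≡x₁v , toℕ-injective x₂u≡x₂v)
    where
    halfTurn : Parity → ℕ
    halfTurn 0ℙ = 0
    halfTurn 1ℙ = p
    x₂≡halfTurn : ∀ x → ⊖ₘ x ≡ x → x₂ x ≡ halfTurn (parity (x₂ x))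
    x₂≡halfTurn x ⊖x≡x with involution-x₂ x ⊖x≡x
    ... | inj₁ x₂≡0 = trans x₂≡0 (cong (halfTurn ∘ parity) (sym x₂≡0))
    ... | inj₂ x₂≡p = trans x₂≡p (cong halfTurn (sym (trans (cong parity x₂≡p) p-odd)))
    x₁u≡x₁v : x₁ u ≡ x₁ v
    x₁u≡x₁v = trans (x₁≡fromParity u) (trans (cong (fromParity ∘ proj₁) κu≡κv) (sym (x₁≡fromParity v)))
    x₂u≡x₂v : x₂ u ≡ x₂ v
    x₂u≡x₂v = trans (x₂≡halfTurn u ⊖u≡u)
                    (trans (cong (halfTurn ∘ proj₂) κu≡κv) (sym (x₂≡halfTurn v ⊖v≡v)))

  module _ {S : List G} (F : FiveRegularConnectionSet m S) where
    open FiveRegularConnectionSet F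

    internal-if-three-preserved : ∀ (A : G → Bool) x {u v w} → u ∈ S → v ∈ S → w ∈ S →
                                  u ≢ v → u ≢ w → v ≢ w →
                                  A (x ⊕ₘ u) ≡ A x → A (x ⊕ₘ v) ≡ A x → A (x ⊕ₘ w) ≡ A x →
                                  otherNbrs m S A x ≤ sameNbrs m S A x
    internal-if-three-preserved A x u∈S v∈S w∈S u≢v u≢w v≢w Au Av Aw =
      filter-∁-≤-filter-of-five Preserved? S size5
        (unique-⊆⇒length-≤ ((u≢v ∷ u≢w ∷ []) ∷ (v≢w ∷ []) ∷ [] ∷ [])
          λ { (here refl) → ∈-filter⁺ Preserved? u∈S Au
            ; (there (here refl)) → ∈-filter⁺ Preserved? v∈S Av
            ; (there (there (here refl))) → ∈-filter⁺ Preserved? w∈S Aw })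
      where
      Preserved? = λ s → A (x ⊕ₘ s) ≟ᵇ A x

    kernelPartition : ∀ k → 3 ≤ count k S → InternalPartition m S
    kernelPartition k 3≤count = record
      { colour = colour
      ; trueClass≠∅ = 𝟘ₘ , dec-true (InKernel? k 𝟘ₘ) (trans (cong (k ·_) κ-𝟘) (·-0ᴷ k))
      ; falseClass≠∅ = outside , dec-false (InKernel? k outside)
                                   λ inside → ℙ.p≢p⁻¹ 0ℙ (trans (sym inside) outside-value)
      ; internal = λ x → filter-∁-≤-filter-of-five (Preserved? x) S size5
          (≤-trans (≤-trans 3≤count (≤-reflexive (sym (filter-InKernel k S))))
            (length-mono-≤ (filter⁺ (InKernel? k) (Preserved? x) (λ { refl → preserved x })
                                    (⊆-refl {x = S}))))
      }
      where
      outside : G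
      outside = proj₁ (κ-surjective (kernelComplement k))
      outside-value : k · κ outside ≡ 1ℙ
      outside-value = trans (cong (k ·_) (proj₂ (κ-surjective (kernelComplement k)))) (·-kernelComplement k)
      colour : G → Bool
      colour x = does (InKernel? k x)
      Preserved? = λ x s → colour (x ⊕ₘ s) ≟ᵇ colour x
      preserved : ∀ x {s} → InKernel k s → colour (x ⊕ₘ s) ≡ colour x
      preserved x s∈ker = cong (λ π → does (π ℙ.≟ 0ℙ)) (·κ-⊕-InKernel k x s∈ker)

    kernelSingleton : ∀ k → count k S ≡ 1 → ∃[ c ] c ∈ S × InKernel k c × ⊖ₘ c ≡ c
    kernelSingleton k count≡1 with filter (InKernel? k) S in eq | trans (filter-InKernel k S) count≡1
    ... | c ∷ [] | _ = c , c∈S , c∈ker , ⊖c≡c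
      where
      c∈S×c∈ker = ∈-filter⁻ (InKernel? k) (subst (c ∈_) (sym eq) (here refl))
      c∈S = proj₁ c∈S×c∈ker
      c∈ker = proj₂ c∈S×c∈ker
      ⊖c≡c : ⊖ₘ c ≡ c
      ⊖c≡c with subst (⊖ₘ c ∈_) eq (∈-filter⁺ (InKernel? k) (symmetric c c∈S) (InKernel-⊖ k {c} c∈ker))
      ... | here ⊖c≡c = ⊖c≡c

    kernelPair : ∀ k → count k S ≡ 2 →
                 ∃[ u ] ∃[ v ] u ≢ v × (u ∈ S × InKernel k u) × (v ∈ S × InKernel k v)
    kernelPair k count≡2 with filter (InKernel? k) S in eq | trans (filter-InKernel k S) count≡2
    ... | u ∷ v ∷ [] | _ = u , v , u≢v , member (here refl) , member (there (here refl))
      where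
      member : ∀ {w} → w ∈ u ∷ v ∷ [] → w ∈ S × InKernel k w
      member w∈ = ∈-filter⁻ (InKernel? k) (subst (_ ∈_) (sym eq) w∈)
      u≢v : u ≢ v
      u≢v with subst Unique eq (Unique.filter⁺ (InKernel? k) distinct)
      ... | (u≢v ∷ []) ∷ _ = u≢v

    module _ (nonzero : ∀ {s} → s ∈ S → κ s ≢ 0ᴷ) where

      κ≡kernelGenerator : ∀ k {s} → s ∈ S → InKernel k s → κ s ≡ kernelGenerator k
      κ≡kernelGenerator k s∈S s∈ker = kernel≡generator k s∈ker (nonzero s∈S)

      distinct-kernels : ∀ {k k′ u v} → k ≢ k′ → u ∈ S → v ∈ S → InKernel k u → InKernel k′ v → u ≢ v
      distinct-kernels {k} {k′} k≢k′ u∈S v∈S u∈ker v∈ker refl =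
        k≢k′ (kernelGenerator-injective
          (trans (sym (κ≡kernelGenerator k u∈S u∈ker)) (κ≡kernelGenerator k′ v∈S v∈ker)))

      outside-other-kernels : ∀ {k k′ s} → k ≢ k′ → s ∈ S → InKernel k s → k′ · κ s ≡ 1ℙ
      outside-other-kernels {k} {k′} {s} k≢k′ s∈S s∈ker with k′ · κ s in eq
      ... | 1ℙ = refl
      ... | 0ℙ = contradiction refl (distinct-kernels k≢k′ s∈S s∈S s∈ker eq)

      module OneTwoTwo {k i j : Character} (k≢i : k ≢ i) (k≢j : k ≢ j) (i≢j : i ≢ j)
                       {c a b : G} (c∈S : c ∈ S) (a∈S : a ∈ S) (b∈S : b ∈ S)
                       (c∈ker : InKernel k c) (a∈ker : InKernel i a) (b∈ker : InKernel j b)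
                       (⊖c≡c : ⊖ₘ c ≡ c) where

        base : Letter → G
        base 𝔞 = a
        base 𝔟 = b

        ⟦_⟧ : Move → G
        ⟦ ℓ , s ⟧ = signed s (base ℓ)

        kernelOf : Letter → Character
        kernelOf 𝔞 = i
        kernelOf 𝔟 = j

        k≢kernelOf : ∀ ℓ → k ≢ kernelOf ℓ
        k≢kernelOf 𝔞 = k≢i
        k≢kernelOf 𝔟 = k≢j

        ⟦⟧∈S : ∀ μ → ⟦ μ ⟧ ∈ S
        ⟦⟧∈S (𝔞 , Sign.+) = a∈S
        ⟦⟧∈S (𝔞 , Sign.-) = symmetric a a∈S
        ⟦⟧∈S (𝔟 , Sign.+) = b∈S
        ⟦⟧∈S (𝔟 , Sign.-) = symmetric b b∈S

        ⟦⟧∈kernelOf : ∀ ℓ s → InKernel (kernelOf ℓ) ⟦ ℓ , s ⟧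
        ⟦⟧∈kernelOf 𝔞 Sign.+ = a∈ker
        ⟦⟧∈kernelOf 𝔞 Sign.- = InKernel-⊖ i {a} a∈ker
        ⟦⟧∈kernelOf 𝔟 Sign.+ = b∈ker
        ⟦⟧∈kernelOf 𝔟 Sign.- = InKernel-⊖ j {b} b∈ker

        c≢⟦⟧ : ∀ μ → c ≢ ⟦ μ ⟧
        c≢⟦⟧ (ℓ , s) = distinct-kernels (k≢kernelOf ℓ) c∈S (⟦⟧∈S (ℓ , s)) c∈ker (⟦⟧∈kernelOf ℓ s)

        𝔞≢𝔟 : ∀ s s′ → ⟦ 𝔞 , s ⟧ ≢ ⟦ 𝔟 , s′ ⟧
        𝔞≢𝔟 s s′ =
          distinct-kernels i≢j (⟦⟧∈S (𝔞 , s)) (⟦⟧∈S (𝔟 , s′)) (⟦⟧∈kernelOf 𝔞 s) (⟦⟧∈kernelOf 𝔟 s′)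

        k·κ⟦⟧ : ∀ μ → k · κ ⟦ μ ⟧ ≡ 1ℙ
        k·κ⟦⟧ (ℓ , s) = outside-other-kernels (k≢kernelOf ℓ ∘ sym) (⟦⟧∈S (ℓ , s)) (⟦⟧∈kernelOf ℓ s)

        internal-if-two-moves : ∀ (A : G → Bool) x μ ν → ⟦ μ ⟧ ≢ ⟦ ν ⟧ →
                                A (x ⊕ₘ c) ≡ A x → A (x ⊕ₘ ⟦ μ ⟧) ≡ A x → A (x ⊕ₘ ⟦ ν ⟧) ≡ A x →
                                otherNbrs m S A x ≤ sameNbrs m S A x
        internal-if-two-moves A x μ ν μ≢ν =
          internal-if-three-preserved A x c∈S (⟦⟧∈S μ) (⟦⟧∈S ν) (c≢⟦⟧ μ) (c≢⟦⟧ ν) μ≢ν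

        module EvenCase (h : ℕ) (p≡h+h : p ≡ h + h) where

          4∣m : 4 ∣ m
          4∣m = divides h (trans (cong (2 *_) p≡h+h) (double h))
            where
            double : ∀ h → 2 * (h + h) ≡ h * 4
            double = solve-∀

          e : ℕ
          e = x₂ c

          2∣e : 2 ∣ e
          2∣e with involution-x₂ c ⊖c≡c
          ... | inj₁ e≡0 = divides 0 e≡0
          ... | inj₂ e≡p = divides h (trans e≡p (trans p≡h+h (sym (h*2≡h+h h))))
            where
            h*2≡h+h : ∀ h → h * 2 ≡ h + h
            h*2≡h+h = solve-∀

          e*-mod-cong : ∀ {y z} → y ≡ z mod 2 → e * y ≡ e * z mod 4
          e*-mod-cong {y} {z} (mod-≡ y≡z) with 2∣e
          ... | divides f e≡f*2 =
            mod-trans (≡⇒mod (reassoc y)) (mod-trans (*-mod-congˡ f twice) (≡⇒mod (sym (reassoc z))))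
            where
            reassoc : ∀ y → e * y ≡ f * (y * 2)
            reassoc y = trans (cong (_* y) e≡f*2) (trans (*-assoc f 2 y) (cong (f *_) (*-comm 2 y)))
            twice : y * 2 ≡ z * 2 mod 4
            twice = mod-≡ (trans (sym (m%n*o≡m*o%[n*o] y 2 2))
                                 (trans (cong (_* 2) y≡z) (m%n*o≡m*o%[n*o] z 2 2)))

          -- A homomorphism G → ℤ₄ killing c; sending 1 ∈ ℤ₂ to e is legitimate since 2e ≡ 0 (mod 4).
          ψ : G → ℕ
          ψ x = x₂ x + e * x₁ x

          ψ-⊕ : ∀ x s → ψ (x ⊕ₘ s) ≡ ψ x + ψ s mod 4
          ψ-⊕ x s = mod-trans (+-mod-cong (mod-weaken 4∣m (x₂-⊕-mod x s)) (e*-mod-cong (x₁-⊕-mod x s)))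
                              (≡⇒mod (rearrange (x₂ x) (x₂ s) e (x₁ x) (x₁ s)))
            where
            rearrange : ∀ a b e u v → (a + b) + e * (u + v) ≡ (a + e * u) + (b + e * v)
            rearrange = solve-∀

          ψ-⊖ : ∀ s → ψ s + ψ (⊖ₘ s) ≡ 0 mod 4
          ψ-⊖ s = mod-trans (≡⇒mod (rearrange (x₂ s) (x₂ (⊖ₘ s)) e (x₁ s) (x₁ (⊖ₘ s))))
                   (mod-trans (+-mod-cong (mod-weaken 4∣m (x₂-⊖-mod s)) (e*-mod-cong (x₁-⊖-mod s)))
                     (≡⇒mod (*-zeroʳ e)))
            where
            rearrange : ∀ a b e u v → (a + e * u) + (b + e * v) ≡ (b + a) + e * (v + u)
            rearrange = solve-∀

          k≡χ₂ : k ≡ χ₂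
          k≡χ₂ = second-kernelGenerator k
                   (trans (cong proj₂ (sym (κ≡kernelGenerator k c∈S c∈ker))) (parity-even 2∣e))

          x₁c≡1 : x₁ c ≡ 1
          x₁c≡1 = trans (x₁≡fromParity c)
                    (cong (fromParity ∘ proj₁) (trans (κ≡kernelGenerator k c∈S c∈ker) (cong kernelGenerator k≡χ₂)))

          ψc≡0 : ψ c ≡ 0 mod 4
          ψc≡0 with 2∣e
          ... | divides f e≡f*2 = mod-≡ (trans (cong (_% 4) ψc≡f*4) (m*n%n≡0 f 4))
            where
            ψc≡f*4 : ψ c ≡ f * 4
            ψc≡f*4 = begin
              e + e * x₁ c     ≡⟨ cong (λ u → e + e * u) x₁c≡1 ⟩
              e + e * 1        ≡⟨ cong (λ u → u + u * 1) e≡f*2 ⟩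
              f * 2 + f * 2 * 1 ≡⟨ f*4 f ⟩
              f * 4            ∎
              where
              open ≡-Reasoning
              f*4 : ∀ f → f * 2 + f * 2 * 1 ≡ f * 4
              f*4 = solve-∀

          parity-ψ : ∀ x → parity (ψ x) ≡ parity (x₂ x)
          parity-ψ x = begin
            parity (x₂ x + e * x₁ x)                 ≡⟨ ℙ.+-homo-+ (x₂ x) (e * x₁ x) ⟩
            parity (x₂ x) ℙ.+ parity (e * x₁ x)      ≡⟨ cong (parity (x₂ x) ℙ.+_) (ℙ.*-homo-* e (x₁ x)) ⟩
            parity (x₂ x) ℙ.+ (parity e ℙ.* parity (x₁ x))
              ≡⟨ cong (λ π → parity (x₂ x) ℙ.+ (π ℙ.* parity (x₁ x))) (parity-even 2∣e) ⟩
            parity (x₂ x) ℙ.+ 0ℙ                     ≡⟨ ℙ.+-identityʳ (parity (x₂ x)) ⟩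
            parity (x₂ x)                            ∎
            where open ≡-Reasoning

          ψ-odd : ∀ μ → parity (ψ ⟦ μ ⟧) ≡ 1ℙ
          ψ-odd (ℓ , s) = begin
            parity (ψ ⟦ ℓ , s ⟧)                   ≡⟨ parity-ψ ⟦ ℓ , s ⟧ ⟩
            proj₂ (κ ⟦ ℓ , s ⟧)
              ≡⟨ cong proj₂ (κ≡kernelGenerator (kernelOf ℓ) (⟦⟧∈S (ℓ , s)) (⟦⟧∈kernelOf ℓ s)) ⟩
            proj₂ (kernelGenerator (kernelOf ℓ))
              ≡⟨ second-kernelGenerator-≢χ₂ (kernelOf ℓ) (k≢kernelOf ℓ ∘ trans k≡χ₂ ∘ sym) ⟩
            1ℙ                                     ∎
            where open ≡-Reasoning

          ψ-opposite : ∀ ℓ → ψ ⟦ ℓ , Sign.+ ⟧ + ψ ⟦ ℓ , Sign.- ⟧ ≡ 0 mod 4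
          ψ-opposite 𝔞 = ψ-⊖ a
          ψ-opposite 𝔟 = ψ-⊖ b

          colour : G → Bool
          colour x = lowHalf (ψ x)

          colour-c : ∀ x → colour (x ⊕ₘ c) ≡ colour x
          colour-c x = lowHalf-cong (mod-trans (ψ-⊕ x c)
                         (mod-trans (+-mod-cong (mod-refl {a = ψ x}) ψc≡0) (≡⇒mod (+-identityʳ (ψ x)))))

          one-sign-keeps : ∀ x ℓ → ∃[ s ] colour (x ⊕ₘ ⟦ ℓ , s ⟧) ≡ colour x
          one-sign-keeps x ℓ with one-step-keeps-half {ψ x} (ψ ⟦ ℓ , Sign.+ ⟧) (ψ ⟦ ℓ , Sign.- ⟧)
                                    (ψ-⊕ x ⟦ ℓ , Sign.+ ⟧) (ψ-⊕ x ⟦ ℓ , Sign.- ⟧)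
                                    (ψ-odd (ℓ , Sign.+)) (ψ-opposite ℓ)
          ... | inj₁ kept = Sign.+ , kept
          ... | inj₂ kept = Sign.- , kept

          partition : InternalPartition m S
          partition = record
            { colour = colour
            ; trueClass≠∅ = 𝟘ₘ , lowHalf-cong (≡⇒mod (cong₂ _+_ x₂-𝟘 (*-zeroʳ e)))
            ; falseClass≠∅ = point 2 2<m , lowHalf-cong (≡⇒mod (cong₂ _+_ (x₂-point 2 2<m) (*-zeroʳ e)))
            ; internal = λ x → let (s , kept) = one-sign-keeps x 𝔞 ; (s′ , kept′) = one-sign-keeps x 𝔟 in
                internal-if-two-moves colour x (𝔞 , s) (𝔟 , s′) (𝔞≢𝔟 s s′) (colour-c x) kept kept′
            }

        module OddCase (h : ℕ) (p≡ : p ≡ suc (h + h)) (⊖a≢a : ⊖ₘ a ≢ a) (⊖b≢b : ⊖ₘ b ≢ b) where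

          open Square (double-mod-cancel h p≡) (x₂ a) (x₂ b)

          signed-injective : ∀ {y} → ⊖ₘ y ≢ y → ∀ s s′ → s ≢ s′ → signed s y ≢ signed s′ y
          signed-injective _ Sign.+ Sign.+ s≢s′ = contradiction refl s≢s′
          signed-injective ⊖y≢y Sign.+ Sign.- _ = ⊖y≢y ∘ sym
          signed-injective ⊖y≢y Sign.- Sign.+ _ = ⊖y≢y
          signed-injective _ Sign.- Sign.- s≢s′ = contradiction refl s≢s′

          ⟦⟧-injective : ∀ μ ν → μ ≢ ν → ⟦ μ ⟧ ≢ ⟦ ν ⟧
          ⟦⟧-injective (𝔞 , s) (𝔞 , s′) μ≢ν = signed-injective ⊖a≢a s s′ (μ≢ν ∘ cong (𝔞 ,_))
          ⟦⟧-injective (𝔟 , s) (𝔟 , s′) μ≢ν = signed-injective ⊖b≢b s s′ (μ≢ν ∘ cong (𝔟 ,_))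
          ⟦⟧-injective (𝔞 , s) (𝔟 , s′) _ = 𝔞≢𝔟 s s′
          ⟦⟧-injective (𝔟 , s) (𝔞 , s′) _ = 𝔞≢𝔟 s′ s ∘ sym

          steps : ∀ x ℓ s → Step p s (size ℓ) (x₂ x) (x₂ (x ⊕ₘ ⟦ ℓ , s ⟧))
          steps x 𝔞 s = Step-weaken p∣m s (x₂-signed-step s x a)
          steps x 𝔟 s = Step-weaken p∣m s (x₂-signed-step s x b)

          layer-flip : ∀ x μ → k · κ (x ⊕ₘ ⟦ μ ⟧) ≡ (k · κ x) ℙ.⁻¹
          layer-flip x μ = begin
            k · κ (x ⊕ₘ ⟦ μ ⟧)          ≡⟨ cong (k ·_) (κ-⊕ x ⟦ μ ⟧) ⟩
            k · (κ x +ᴷ κ ⟦ μ ⟧)        ≡⟨ ·-homo k (κ x) (κ ⟦ μ ⟧) ⟩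
            k · κ x ℙ.+ k · κ ⟦ μ ⟧     ≡⟨ cong (k · κ x ℙ.+_) (k·κ⟦⟧ μ) ⟩
            k · κ x ℙ.+ 1ℙ              ≡⟨ ℙ.+-comm (k · κ x) 1ℙ ⟩
            (k · κ x) ℙ.⁻¹              ∎
            where open ≡-Reasoning

          x₂c≡0 : x₂ c ≡ 0 mod p
          x₂c≡0 with involution-x₂ c ⊖c≡c
          ... | inj₁ x₂c≡0 = ≡⇒mod x₂c≡0
          ... | inj₂ x₂c≡p = mod-trans (≡⇒mod x₂c≡p) n≡0-mod

          colour : G → Bool
          colour x = onSquare (k · κ x) (x₂ x)

          colour-c : ∀ x → colour (x ⊕ₘ c) ≡ colour x
          colour-c x = trans (cong (λ ε → onSquare ε (x₂ (x ⊕ₘ c))) (·κ-⊕-InKernel k x c∈ker))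
                         (onSquare-cong (k · κ x) x₂-shift)
            where
            x₂-shift : x₂ (x ⊕ₘ c) ≡ x₂ x mod p
            x₂-shift = mod-trans (mod-weaken p∣m (x₂-⊕-mod x c))
                         (mod-trans (+-mod-cong (mod-refl {a = x₂ x}) x₂c≡0) (≡⇒mod (+-identityʳ (x₂ x))))

          internal : ∀ x → otherNbrs m S colour x ≤ sameNbrs m S colour x
          internal x = internal-if-two-moves colour x first second (⟦⟧-injective first second first≢second)
                         (colour-c x) (keeps first keeps-first) (keeps second keeps-second)
            where
            open TwoMoves (square-keeps-two (k · κ x) (x₂ x) (λ μ → x₂ (x ⊕ₘ ⟦ μ ⟧)) (steps x))
            keeps : ∀ μ → Keeps (k · κ x) (x₂ x) (λ ν → x₂ (x ⊕ₘ ⟦ ν ⟧)) μ →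
                    colour (x ⊕ₘ ⟦ μ ⟧) ≡ colour x
            keeps μ = trans (cong (λ ε → onSquare ε (x₂ (x ⊕ₘ ⟦ μ ⟧))) (layer-flip x μ))

          2<p : 2 < p
          2<p = subst (2 <_) (sym p≡) (three≤ h (subst (1 <_) p≡ 1<p))
            where
            three≤ : ∀ h → 1 < suc (h + h) → 2 < suc (h + h)
            three≤ zero (s≤s ())
            three≤ (suc h) _ = s≤s (s≤s (subst (1 ≤_) (sym (+-suc h h)) (s≤s z≤n)))

          colour-even-point : ∀ t (t<m : t < m) → parity t ≡ 0ℙ → ¬ Corner 0ℙ t →
                              colour (point t t<m) ≡ false
          colour-even-point t t<m t-even off =
            trans (cong₂ onSquare layer₀ (x₂-point t t<m)) (dec-false (Corner? 0ℙ t) off)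
            where
            layer₀ : k · κ (point t t<m) ≡ 0ℙ
            layer₀ = trans (cong (k ·_) (trans (κ-point t t<m) (cong (0ℙ ,_) t-even))) (·-0ᴷ k)

          off-square : ∃[ x ] colour x ≡ false
          off-square with mod-dec {p} 2 (x₂ a + x₂ b)
          ... | no 2≢α+β = point 2 2<m , colour-even-point 2 2<m refl Sum.[ 2≢0 , 2≢α+β ]
            where
            2≢0 : ¬ 2 ≡ 0 mod p
            2≢0 = (λ ()) ∘ mod-injective-< 2<p (>-nonZero⁻¹ p)
          ... | yes 2≡α+β =
            point (suc p) p+1<m , colour-even-point (suc p) p+1<m p+1-even Sum.[ p+1≢0 , p+1≢α+β ]
            where
            p+1<m : suc p < m
            p+1<m = subst₂ _<_ (+-comm p 1) (cong (p +_) (sym (+-identityʳ p))) (+-monoʳ-< p 1<p)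
            p+1-even : parity (suc p) ≡ 0ℙ
            p+1-even = trans (cong (parity ∘ suc) p≡) (parity-double h)
            p+1≡1 : suc p ≡ 1 mod p
            p+1≡1 = mod-≡ ([m+n]%n≡m%n 1 p)
            p+1≢0 : ¬ suc p ≡ 0 mod p
            p+1≢0 p+1≡0 = contradiction
              (mod-injective-< 1<p (>-nonZero⁻¹ p) (mod-trans (mod-sym p+1≡1) p+1≡0)) λ ()
            p+1≢α+β : ¬ suc p ≡ x₂ a + x₂ b mod p
            p+1≢α+β p+1≡α+β = contradiction
              (mod-injective-< 1<p 2<p (mod-trans (mod-sym p+1≡1) (mod-trans p+1≡α+β (mod-sym 2≡α+β)))) λ ()

          partition : InternalPartition m S
          partition = record
            { colour = colour
            ; trueClass≠∅ = 𝟘ₘ , trans (cong₂ onSquare (trans (cong (k ·_) κ-𝟘) (·-0ᴷ k)) x₂-𝟘)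
                                       (dec-true (Corner? 0ℙ 0) (inj₁ mod-refl))
            ; falseClass≠∅ = off-square
            ; internal = internal
            }

      -- For odd p an involution is determined by κ, and both elements of S in ker k have the same κ.
      nonInvolutionInKernel : parity p ≡ 1ℙ → ∀ k → count k S ≡ 2 → ∃[ a ] (a ∈ S × InKernel k a) × ⊖ₘ a ≢ a
      nonInvolutionInKernel p-odd k count≡2 with kernelPair k count≡2
      ... | u , v , u≢v , u∈ , v∈ with ⊖ₘ u ≟ᴳ u | ⊖ₘ v ≟ᴳ v
      ...   | no ⊖u≢u | _ = u , u∈ , ⊖u≢u
      ...   | yes _ | no ⊖v≢v = v , v∈ , ⊖v≢v
      ...   | yes ⊖u≡u | yes ⊖v≡v = contradiction (involution-determined-by-κ p-odd ⊖u≡u ⊖v≡v κu≡κv) u≢v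
        where
        κu≡κv : κ u ≡ κ v
        κu≡κv = trans (κ≡kernelGenerator k (proj₁ u∈) (proj₂ u∈))
                      (sym (κ≡kernelGenerator k (proj₁ v∈) (proj₂ v∈)))

      oneTwoTwoPartition : ∀ {k i j} → k ≢ i → k ≢ j → i ≢ j →
                           count k S ≡ 1 → count i S ≡ 2 → count j S ≡ 2 → InternalPartition m S
      oneTwoTwoPartition {k} {i} {j} k≢i k≢j i≢j count-k count-i count-j
        with kernelSingleton k count-k | even-or-odd p
      ... | c , c∈S , c∈ker , ⊖c≡c | inj₁ (h , p≡h+h) =
        let (a , _ , _ , (a∈S , a∈ker) , _) = kernelPair i count-i
            (b , _ , _ , (b∈S , b∈ker) , _) = kernelPair j count-j
        in OneTwoTwo.EvenCase.partition k≢i k≢j i≢j c∈S a∈S b∈S c∈ker a∈ker b∈ker ⊖c≡c h p≡h+h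
      ... | c , c∈S , c∈ker , ⊖c≡c | inj₂ (h , p≡1+h+h) =
        let p-odd = trans (cong parity p≡1+h+h) (parity-double+1 h)
            (a , (a∈S , a∈ker) , ⊖a≢a) = nonInvolutionInKernel p-odd i count-i
            (b , (b∈S , b∈ker) , ⊖b≢b) = nonInvolutionInKernel p-odd j count-j
        in OneTwoTwo.OddCase.partition k≢i k≢j i≢j c∈S a∈S b∈S c∈ker a∈ker b∈ker ⊖c≡c h p≡1+h+h ⊖a≢a ⊖b≢b

    module _ (≤2₁ : count χ₁ S ≤ 2) (≤2₂ : count χ₂ S ≤ 2) (≤2₃ : count χ₃ S ≤ 2) where

      count-sum : count χ₁ S + count χ₂ S + count χ₃ S ≡ 5 + 2 * zeroCount (map κ S)
      count-sum = trans (kernelCount-sum (map κ S))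
                        (cong (_+ 2 * zeroCount (map κ S)) (trans (length-map κ S) size5))

      no-zeros : zeroCount (map κ S) ≡ 0
      no-zeros = ≤2-sum≡5+2z⇒z≡0 (zeroCount (map κ S)) ≤2₁ ≤2₂ ≤2₃ count-sum

      nonzero : ∀ {s} → s ∈ S → κ s ≢ 0ᴷ
      nonzero s∈S κs≡0 =
        <⇒≢ (filter-some (_≟ᴷ 0ᴷ) (Any.map⁺ (Any.map (λ { refl → κs≡0 }) s∈S))) (sym no-zeros)

      smallKernelsPartition : InternalPartition m S
      smallKernelsPartition with one-two-two ≤2₁ ≤2₂ ≤2₃ (trans count-sum (cong (λ z → 5 + 2 * z) no-zeros))
      ... | inj₁ (c₁ , c₂ , c₃) = oneTwoTwoPartition nonzero {χ₁} {χ₂} {χ₃} (λ ()) (λ ()) (λ ()) c₁ c₂ c₃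
      ... | inj₂ (inj₁ (c₁ , c₂ , c₃)) = oneTwoTwoPartition nonzero {χ₂} {χ₁} {χ₃} (λ ()) (λ ()) (λ ()) c₂ c₁ c₃
      ... | inj₂ (inj₂ (c₁ , c₂ , c₃)) = oneTwoTwoPartition nonzero {χ₃} {χ₁} {χ₂} (λ ()) (λ ()) (λ ()) c₃ c₁ c₂

    internalPartition : InternalPartition m S
    internalPartition with 3 ≤? count χ₁ S | 3 ≤? count χ₂ S | 3 ≤? count χ₃ S
    ... | yes large | _ | _ = kernelPartition χ₁ large
    ... | no _ | yes large | _ = kernelPartition χ₂ large
    ... | no _ | no _ | yes large = kernelPartition χ₃ large
    ... | no ¬large₁ | no ¬large₂ | no ¬large₃ =
      smallKernelsPartition (s≤s⁻¹ (≰⇒> ¬large₁)) (s≤s⁻¹ (≰⇒> ¬large₂)) (s≤s⁻¹ (≰⇒> ¬large₃))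

mainTheorem14 : (p : ℕ) → (p>1 : 1 < p) → (S : List (Z2xZ (2 * p))) →
                FiveRegularConnectionSet (2 * p) {{2p≢0 p>1}} S →
                InternalPartition (2 * p) {{2p≢0 p>1}} S
mainTheorem14 p p>1 S F = ℤ₂×ℤ₂ₚ.internalPartition p p>1 F
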